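{- Let $B$ and $r$ be positive integers with $B/3<r\le B/2$. Consider the following uneven-splitting block process. It starts with a single block of $r$ keys (total number of keys $n=r$). Whenever the total number of keys is $n$, a batch of $r$ keys is inserted into one existing block chosen at random, a block of size $s$ being chosen with probability $s/n$; if the chosen block has $r$ keys it becomes a block of $2r$ keys (no overflow since $2r\le B$), and if it has $2r$ keys, then when it becomes full and must split it is split by the subroutine TargetSplit with targets $f_L=r$, $f_R=2r$, so that at the end of the batch it has been replaced by two blocks of sizes $r$ and $2r$. Let $X^n$ be the number of blocks when the total number of keys is $n$ (so $n\in\{r,2r,3r,\dots\}$). Then $n/\mathbb{E}[X^n]\to \frac{3r}{2}$ as $n\to\infty$.
   Context: TargetSplit$(A,k,f_L,f_R)$, for a full block $A$ with sorted keys $k_1<\dots<k_B$, a new key $k$ of an ongoing batch, and targets with $f_L+f_R>B$: let $j=|\{i:k_i<k\}|$. If $j\ge f_L$, split $A$ into $A_L=k_1,\dots,k_{f_L}$ and $A_R=k_{f_L+1},\dots,k_B$, and insert $k$ and the next $f_L+f_R-B-1$ keys of the batch into $A_R$. Else if $j\le B-f_R$, split into $A_L=k_1,\dots,k_{B-f_R}$ and $A_R=k_{B-f_R+1},\dots,k_B$ and insert $k$ and the next $f_L+f_R-B-1$ keys into $A_L$. Otherwise split into $A_L=k_1,\dots,k_j$, $A_R=k_{j+1},\dots,k_B$, insert $k$ and the next $f_L-j-1$ keys into $A_L$, then the next $f_R+j-B$ keys into $A_R$. The average block size is the total number of keys divided by the number of blocks. -}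

module Defs where

open import Data.Nat as ℕ using (ℕ; zero; suc; _≡ᵇ_)
open import Data.Bool using (if_then_else_)
open import Data.Integer using (+_)
open import Data.List using (List; []; _∷_; _++_; map; concatMap; length)
open import Data.Nat.ListAction using (sum)
open import Data.Product using (_×_; _,_)
open import Data.Rational as ℚ using (ℚ; 0ℚ; 1ℚ; _/_; _*_; _+_; _÷_; ≢-nonZero)
open import Relation.Nullary using (yes; no)

-- A configuration of the block process: the list of block sizes (numbers of keys).
Config : Set
Config = List ℕ

-- Natural-number fraction a / b as a rational (b is always positive where used;
-- the b = 0 branch is a totality convention and never reached).
frac : ℕ → ℕ → ℚ
frac a zero    = 0ℚ
frac a (suc b) = (+ a) / suc b

-- Blocks replacing a chosen block of size s after receiving a batch of r keys:
-- a block of r keys becomes a block of 2r keys; a block of 2r keys is split by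
-- TargetSplit with f_L = r, f_R = 2r and ends the batch as blocks of sizes r and 2r.
-- (Other sizes never occur; they are left unchanged by convention.)
afterBatch : ℕ → ℕ → Config
afterBatch r s =
  if s ≡ᵇ r then (2 ℕ.* r) ∷ []
  else if s ≡ᵇ (2 ℕ.* r) then r ∷ (2 ℕ.* r) ∷ []
  else s ∷ []

choices : ℕ → Config → List (ℕ × Config)
choices r []       = []
choices r (s ∷ bs) =
  (s , afterBatch r s ++ bs) ∷ map (λ { (t , bs') → (t , s ∷ bs') }) (choices r bs)

Dist : Set
Dist = List (ℚ × Config)

step : ℕ → Dist → Dist
step r = concatMap (λ { (p , bs) →
  map (λ { (s , bs') → (p * frac s (sum bs) , bs') }) (choices r bs) })

-- Distribution after m batches (total number of keys n = r (m + 1)).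
dist : ℕ → ℕ → Dist
dist r zero    = (1ℚ , r ∷ []) ∷ []
dist r (suc m) = step r (dist r m)

-- E[X^n] for n = r (m + 1): expected number of blocks.
expBlocks : ℕ → ℕ → ℚ
expBlocks r m = go (dist r m)
  where
  go : Dist → ℚ
  go []              = 0ℚ
  go ((p , bs) ∷ d)  = p * frac (length bs) 1 + go d

-- Rational division, with x ÷ 0 := 0 as a totality convention
-- (never relevant here since E[X^n] ≥ 1).
divQ : ℚ → ℚ → ℚ
divQ x y with y ℚ.≟ 0ℚ
... | yes _  = 0ℚ
... | no y≢0 = _÷_ x y {{≢-nonZero y≢0}}

{-# OPTIONS --safe #-}
-- Every configuration reachable after m batches consists of blocks of sizes r and 2r holding
-- n = rk keys, k = m + 1.  With L blocks, b of them of size 2r, a batch adds a block exactly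
-- when it hits a 2r-block, which happens with probability 2rb/n = 2 − 2L/k since rb = n − rL.
-- By linearity of expectation e_m = E[X^n] satisfies k e_{m+1} = (k − 2) e_m + 2k.  At k = 2
-- the coefficient vanishes, so e_2 = 2, and induction gives 3 e_m = 2(m + 1) for all m ≥ 2:
-- from the third batch on, n / E[X^n] is exactly 3r/2.
module Submission where

open import Defs
open import Data.Nat using (ℕ; suc; _≤_; _<_; _*_)
open import Data.Integer using (+_)
open import Data.Product using (∃-syntax)
open import Data.Rational as ℚ using (ℚ; 0ℚ; _/_; ∣_∣; _-_)

open import Data.Integer as ℤ using ()
open import Data.Integer.Properties as ℤ using ()
open import Data.List using (List; []; _∷_; _++_; map; length)
open import Data.List.Properties using (length-++)
open import Data.List.Relation.Unary.All as All using (All; []; _∷_)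
open import Data.List.Relation.Unary.All.Properties using (++⁺; map⁺)
open import Data.Nat as ℕ using (zero; _+_; z≤n; s≤s)
open import Data.Nat.ListAction using (sum)
open import Data.Nat.ListAction.Properties using (sum-++)
import Data.Nat.Properties as ℕ
open import Data.Nat.Tactic.RingSolver using () renaming (solve-∀ to ℕ-solve-∀)
open import Data.Product using (_×_; _,_; proj₂; map₁; map₂)
open import Data.Rational using (1ℚ; fromℚᵘ)
open import Data.Rational.Properties as ℚ using (toℚᵘ-injective; toℚᵘ-fromℚᵘ; fromℚᵘ-cong)
open import Data.Rational.Unnormalised as ℚᵘ using (ℚᵘ; mkℚᵘ; *≡*)
open import Data.Rational.Unnormalised.Properties as ℚᵘ using ()
open import Function using (_∘_)
open import Algebra.Properties.CommutativeSemigroup ℕ.+-commutativeSemigroup using (x∙yz≈y∙xz)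
open import Algebra.Properties.Group ℚ.+-0-group using () renaming (∙-cancelʳ to +-cancelʳ)
open import Relation.Binary.PropositionalEquality
open import Relation.Nullary using (yes; no; contradiction)
open import Relation.Nullary.Decidable using (dec⇒maybe; dec-true; dec-false)
open import Tactic.RingSolver using (solve-∀)
open import Tactic.RingSolver.Core.AlmostCommutativeRing using (AlmostCommutativeRing; fromCommutativeRing)

open ≡-Reasoning

ℚ-ring : AlmostCommutativeRing _ _
ℚ-ring = fromCommutativeRing ℚ.+-*-commutativeRing (λ x → dec⇒maybe (0ℚ ℚ.≟ x))

ιᵘ : ℕ → ℚᵘ
ιᵘ n = mkℚᵘ (+ n) 0

ι : ℕ → ℚ
ι n = frac n 1

fromℚᵘ-homo-+ : ∀ p q → fromℚᵘ (p ℚᵘ.+ q) ≡ fromℚᵘ p ℚ.+ fromℚᵘ q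
fromℚᵘ-homo-+ p q = toℚᵘ-injective (ℚᵘ.≃-trans (toℚᵘ-fromℚᵘ (p ℚᵘ.+ q)) (ℚᵘ.≃-sym
  (ℚᵘ.≃-trans (ℚ.toℚᵘ-homo-+ (fromℚᵘ p) (fromℚᵘ q)) (ℚᵘ.+-cong (toℚᵘ-fromℚᵘ p) (toℚᵘ-fromℚᵘ q)))))

fromℚᵘ-homo-* : ∀ p q → fromℚᵘ (p ℚᵘ.* q) ≡ fromℚᵘ p ℚ.* fromℚᵘ q
fromℚᵘ-homo-* p q = toℚᵘ-injective (ℚᵘ.≃-trans (toℚᵘ-fromℚᵘ (p ℚᵘ.* q)) (ℚᵘ.≃-sym
  (ℚᵘ.≃-trans (ℚ.toℚᵘ-homo-* (fromℚᵘ p) (fromℚᵘ q)) (ℚᵘ.*-cong (toℚᵘ-fromℚᵘ p) (toℚᵘ-fromℚᵘ q)))))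

ι-homo-+ : ∀ m n → ι (m + n) ≡ ι m ℚ.+ ι n
ι-homo-+ m n = trans (fromℚᵘ-cong {ιᵘ (m + n)} {ιᵘ m ℚᵘ.+ ιᵘ n} (*≡* (cong (ℤ._* + 1) numerators)))
  (fromℚᵘ-homo-+ (ιᵘ m) (ιᵘ n))
  where
  numerators : + (m + n) ≡ + m ℤ.* + 1 ℤ.+ + n ℤ.* + 1
  numerators = trans (ℤ.pos-+ m n) (sym (cong₂ ℤ._+_ (ℤ.*-identityʳ (+ m)) (ℤ.*-identityʳ (+ n))))

ι-homo-* : ∀ m n → ι (m * n) ≡ ι m ℚ.* ι n
ι-homo-* m n = trans (fromℚᵘ-cong {ιᵘ (m * n)} {ιᵘ m ℚᵘ.* ιᵘ n} (*≡* (cong (ℤ._* + 1) (ℤ.pos-* m n))))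
  (fromℚᵘ-homo-* (ιᵘ m) (ιᵘ n))

frac-*-ι : ∀ m n → frac m (suc n) ℚ.* ι (suc n) ≡ ι m
frac-*-ι m n = trans (sym (fromℚᵘ-homo-* (mkℚᵘ (+ m) n) (ιᵘ (suc n))))
  (fromℚᵘ-cong {mkℚᵘ (+ m) n ℚᵘ.* ιᵘ (suc n)} {ιᵘ m} (*≡* cross))
  where
  cross : (+ m ℤ.* + suc n) ℤ.* + 1 ≡ + m ℤ.* + suc (n * 1)
  cross = trans (ℤ.*-identityʳ _) (cong (λ d → + m ℤ.* + suc d) (sym (ℕ.*-identityʳ n)))

*-cancelˡ-ι : ∀ {n} → 0 < n → ∀ {x y} → ι n ℚ.* x ≡ ι n ℚ.* y → x ≡ y
*-cancelˡ-ι {suc n} _ {x} {y} eq = begin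
  x                                      ≡⟨ divide x ⟩
  frac 1 (suc n) ℚ.* (ι (suc n) ℚ.* x)  ≡⟨ cong (frac 1 (suc n) ℚ.*_) eq ⟩
  frac 1 (suc n) ℚ.* (ι (suc n) ℚ.* y)  ≡⟨ divide y ⟨
  y                                      ∎
  where
  divide : ∀ z → z ≡ frac 1 (suc n) ℚ.* (ι (suc n) ℚ.* z)
  divide z = begin
    z                                     ≡⟨ ℚ.*-identityˡ z ⟨
    1ℚ ℚ.* z                              ≡⟨ cong (ℚ._* z) (frac-*-ι 1 n) ⟨
    frac 1 (suc n) ℚ.* ι (suc n) ℚ.* z    ≡⟨ ℚ.*-assoc (frac 1 (suc n)) (ι (suc n)) z ⟩
    frac 1 (suc n) ℚ.* (ι (suc n) ℚ.* z)  ∎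

ι≢0 : ∀ {n} → 0 < n → ι n ≢ 0ℚ
ι≢0 {suc n} _ ιn≡0 with () ← begin
  1ℚ                            ≡⟨ frac-*-ι 1 n ⟨
  frac 1 (suc n) ℚ.* ι (suc n)  ≡⟨ cong (frac 1 (suc n) ℚ.*_) ιn≡0 ⟩
  frac 1 (suc n) ℚ.* 0ℚ         ≡⟨ ℚ.*-zeroʳ (frac 1 (suc n)) ⟩
  0ℚ                            ∎

𝔼 : (Config → ℚ) → Dist → ℚ
𝔼 f []            = 0ℚ
𝔼 f ((p , c) ∷ d) = p ℚ.* f c ℚ.+ 𝔼 f d

one : Config → ℚ
one _ = 1ℚ

blocks : Config → ℚ
blocks c = ι (length c)

𝔼-++ : ∀ f d e → 𝔼 f (d ++ e) ≡ 𝔼 f d ℚ.+ 𝔼 f e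
𝔼-++ f []            e = sym (ℚ.+-identityˡ (𝔼 f e))
𝔼-++ f ((p , c) ∷ d) e =
  trans (cong (p ℚ.* f c ℚ.+_) (𝔼-++ f d e)) (sym (ℚ.+-assoc (p ℚ.* f c) (𝔼 f d) (𝔼 f e)))

𝔼-linear : ∀ a b f g d →
  𝔼 (λ c → a ℚ.* f c ℚ.+ b ℚ.* g c) d ≡ a ℚ.* 𝔼 f d ℚ.+ b ℚ.* 𝔼 g d
𝔼-linear a b f g []            = sym (trans (cong₂ ℚ._+_ (ℚ.*-zeroʳ a) (ℚ.*-zeroʳ b)) (ℚ.+-identityˡ 0ℚ))
𝔼-linear a b f g ((p , c) ∷ d) = begin
  p ℚ.* (a ℚ.* f c ℚ.+ b ℚ.* g c) ℚ.+ 𝔼 (λ c → a ℚ.* f c ℚ.+ b ℚ.* g c) d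
    ≡⟨ cong (p ℚ.* (a ℚ.* f c ℚ.+ b ℚ.* g c) ℚ.+_) (𝔼-linear a b f g d) ⟩
  p ℚ.* (a ℚ.* f c ℚ.+ b ℚ.* g c) ℚ.+ (a ℚ.* 𝔼 f d ℚ.+ b ℚ.* 𝔼 g d) ≡⟨ regroup p a b (f c) (g c) (𝔼 f d) (𝔼 g d) ⟩
  a ℚ.* (p ℚ.* f c ℚ.+ 𝔼 f d) ℚ.+ b ℚ.* (p ℚ.* g c ℚ.+ 𝔼 g d)     ∎
  where
  regroup : ∀ p a b x y F G →
    p ℚ.* (a ℚ.* x ℚ.+ b ℚ.* y) ℚ.+ (a ℚ.* F ℚ.+ b ℚ.* G) ≡ a ℚ.* (p ℚ.* x ℚ.+ F) ℚ.+ b ℚ.* (p ℚ.* y ℚ.+ G)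
  regroup = solve-∀ ℚ-ring

𝔼-cong : ∀ {P : Config → Set} {f g} {d} → (∀ {c} → P c → f c ≡ g c) → All (P ∘ proj₂) d →
  𝔼 f d ≡ 𝔼 g d
𝔼-cong f≗g []       = refl
𝔼-cong {d = (p , _) ∷ _} f≗g (pc ∷ pd) = cong₂ (λ x y → p ℚ.* x ℚ.+ y) (f≗g pc) (𝔼-cong f≗g pd)

𝔼-scaleWeights : ∀ f p (w : ℕ → ℚ) (xs : List (ℕ × Config)) →
  𝔼 f (map (map₁ (λ s → p ℚ.* w s)) xs) ≡ p ℚ.* 𝔼 f (map (map₁ w) xs)
𝔼-scaleWeights f p w []            = sym (ℚ.*-zeroʳ p)
𝔼-scaleWeights f p w ((s , c) ∷ xs) =
  trans (cong (p ℚ.* w s ℚ.* f c ℚ.+_) (𝔼-scaleWeights f p w xs)) (factor p (w s) (f c) _)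
  where
  factor : ∀ p w x E → p ℚ.* w ℚ.* x ℚ.+ p ℚ.* E ≡ p ℚ.* (w ℚ.* x ℚ.+ E)
  factor = solve-∀ ℚ-ring

batch : ℕ → Config → Dist
batch r c = map (map₁ (λ s → frac s (sum c))) (choices r c)

𝔼-step : ∀ r f d → 𝔼 f (step r d) ≡ 𝔼 (𝔼 f ∘ batch r) d
𝔼-step r f []            = refl
𝔼-step r f ((p , c) ∷ d) =
  trans (𝔼-++ f (map (map₁ (λ s → p ℚ.* frac s (sum c))) (choices r c)) (step r d))
        (cong₂ ℚ._+_ (𝔼-scaleWeights f p (λ s → frac s (sum c)) (choices r c)) (𝔼-step r f d))

step-support : ∀ {P Q : Config → Set} r → (∀ {c} → P c → All (Q ∘ proj₂) (choices r c)) →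
  ∀ {d} → All (P ∘ proj₂) d → All (Q ∘ proj₂) (step r d)
step-support r next []        = []
step-support r next (pc ∷ pd) = ++⁺ (map⁺ (next pc)) (step-support r next pd)

𝔼-unique : ∀ {f} {g : Dist → ℚ} → g [] ≡ 0ℚ → (∀ p c d → g ((p , c) ∷ d) ≡ p ℚ.* f c ℚ.+ g d) →
  ∀ d → g d ≡ 𝔼 f d
𝔼-unique g[] g∷ []            = g[]
𝔼-unique {f} g[] g∷ ((p , c) ∷ d) = trans (g∷ p c d) (cong (p ℚ.* f c ℚ.+_) (𝔼-unique g[] g∷ d))

-- expBlocks sums with a local function of Defs that cannot be named here; abstracting over
-- dist r m lets unification recover it as the g of 𝔼-unique.
expBlocks≡𝔼 : ∀ r m → expBlocks r m ≡ 𝔼 blocks (dist r m)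
expBlocks≡𝔼 r m with dist r m | 𝔼-unique {blocks} refl (λ _ _ _ → refl)
... | d | g≡𝔼 = g≡𝔼 d

weighted : (Config → ℕ) → List (ℕ × Config) → ℕ
weighted φ []             = 0
weighted φ ((s , c) ∷ xs) = s * φ c + weighted φ xs

weighted-prefix : ∀ φ s xs → weighted φ (map (map₂ (s ∷_)) xs) ≡ weighted (φ ∘ (s ∷_)) xs
weighted-prefix φ s []             = refl
weighted-prefix φ s ((t , c) ∷ xs) = cong (_+_ (t * φ (s ∷ c))) (weighted-prefix φ s xs)

weighted-+ : ∀ φ ψ xs → weighted (λ c → φ c + ψ c) xs ≡ weighted φ xs + weighted ψ xs
weighted-+ φ ψ []             = refl
weighted-+ φ ψ ((s , c) ∷ xs) = begin
  s * (φ c + ψ c) + weighted (λ c → φ c + ψ c) xs     ≡⟨ cong (_+_ (s * (φ c + ψ c))) (weighted-+ φ ψ xs) ⟩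
  s * (φ c + ψ c) + (weighted φ xs + weighted ψ xs)  ≡⟨ distrib s (φ c) (ψ c) (weighted φ xs) (weighted ψ xs) ⟩
  s * φ c + weighted φ xs + (s * ψ c + weighted ψ xs) ∎
  where
  distrib : ∀ s x y X Y → s * (x + y) + (X + Y) ≡ s * x + X + (s * y + Y)
  distrib = ℕ-solve-∀

weighted-one-choices : ∀ r c → weighted (λ _ → 1) (choices r c) ≡ sum c
weighted-one-choices r []      = refl
weighted-one-choices r (s ∷ c) =
  cong₂ _+_ (ℕ.*-identityʳ s) (trans (weighted-prefix (λ _ → 1) s (choices r c)) (weighted-one-choices r c))

𝔼-fracWeights : ∀ {n} → 0 < n → ∀ φ (xs : List (ℕ × Config)) →
  ι n ℚ.* 𝔼 (ι ∘ φ) (map (map₁ (λ s → frac s n)) xs) ≡ ι (weighted φ xs)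
𝔼-fracWeights {suc n} _ φ []             = ℚ.*-zeroʳ (ι (suc n))
𝔼-fracWeights {suc n} n>0 φ ((s , c) ∷ xs) = begin
  ι (suc n) ℚ.* (frac s (suc n) ℚ.* ι (φ c) ℚ.+ E)
    ≡⟨ distrib (ι (suc n)) (frac s (suc n)) (ι (φ c)) E ⟩
  frac s (suc n) ℚ.* ι (suc n) ℚ.* ι (φ c) ℚ.+ ι (suc n) ℚ.* E
    ≡⟨ cong₂ (λ a b → a ℚ.* ι (φ c) ℚ.+ b) (frac-*-ι s n) (𝔼-fracWeights n>0 φ xs) ⟩
  ι s ℚ.* ι (φ c) ℚ.+ ι (weighted φ xs)
    ≡⟨ cong (ℚ._+ ι (weighted φ xs)) (ι-homo-* s (φ c)) ⟨
  ι (s * φ c) ℚ.+ ι (weighted φ xs)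
    ≡⟨ ι-homo-+ (s * φ c) (weighted φ xs) ⟨
  ι (s * φ c + weighted φ xs) ∎
  where
  E : ℚ
  E = 𝔼 (ι ∘ φ) (map (map₁ (λ s → frac s (suc n))) xs)
  distrib : ∀ m f x E → m ℚ.* (f ℚ.* x ℚ.+ E) ≡ f ℚ.* m ℚ.* x ℚ.+ m ℚ.* E
  distrib = solve-∀ ℚ-ring

-- The first step uses that one is ι ∘ (λ _ → 1) definitionally: ι 1 computes to 1ℚ.
batch-mass : ∀ r c → 0 < sum c → 𝔼 one (batch r c) ≡ 1ℚ
batch-mass r c n>0 = *-cancelˡ-ι n>0 (begin
  ι (sum c) ℚ.* 𝔼 one (batch r c)          ≡⟨ 𝔼-fracWeights n>0 (λ _ → 1) (choices r c) ⟩
  ι (weighted (λ _ → 1) (choices r c))     ≡⟨ cong ι (weighted-one-choices r c) ⟩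
  ι (sum c)                                ≡⟨ ℚ.*-identityʳ (ι (sum c)) ⟨
  ι (sum c) ℚ.* 1ℚ                         ∎)

data BlockSize (r : ℕ) : ℕ → Set where
  single : BlockSize r r
  double : BlockSize r (2 * r)

WellFormed : ℕ → ℕ → Config → Set
WellFormed r k c = All (BlockSize r) c × sum c ≡ r * k

afterBatch-single : ∀ r → afterBatch r r ≡ 2 * r ∷ []
afterBatch-single r rewrite dec-true (r ℕ.≟ r) refl = refl

2*r≢r : ∀ {r} → 0 < r → 2 * r ≢ r
2*r≢r {suc r} _ = ℕ.m+1+n≢m (suc r)

afterBatch-double : ∀ {r} → 0 < r → afterBatch r (2 * r) ≡ r ∷ 2 * r ∷ []
afterBatch-double {r} r>0
  rewrite dec-false (2 * r ℕ.≟ r) (2*r≢r r>0) | dec-true (2 * r ℕ.≟ 2 * r) refl = refl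

module _ {r : ℕ} (r>0 : 0 < r) where

  afterBatch-blockSize : ∀ {s} → BlockSize r s → All (BlockSize r) (afterBatch r s)
  afterBatch-blockSize single rewrite afterBatch-single r = double ∷ []
  afterBatch-blockSize double rewrite afterBatch-double r>0 = single ∷ double ∷ []

  sum-afterBatch : ∀ {s} → BlockSize r s → sum (afterBatch r s) ≡ r + s
  sum-afterBatch single rewrite afterBatch-single r =
    trans (ℕ.+-identityʳ (2 * r)) (cong (_+_ r) (ℕ.+-identityʳ r))
  sum-afterBatch double rewrite afterBatch-double r>0 = cong (_+_ r) (ℕ.+-identityʳ (2 * r))

  length-afterBatch : ∀ {s} → BlockSize r s → s * length (afterBatch r s) + 2 * r ≡ 3 * s
  length-afterBatch single rewrite afterBatch-single r = r+2r≡3r r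
    where
    r+2r≡3r : ∀ r → r * 1 + 2 * r ≡ 3 * r
    r+2r≡3r = ℕ-solve-∀
  length-afterBatch double rewrite afterBatch-double r>0 = 4r+2r≡6r r
    where
    4r+2r≡6r : ∀ r → 2 * r * 2 + 2 * r ≡ 3 * (2 * r)
    4r+2r≡6r = ℕ-solve-∀

  choices-wellFormed : ∀ {c} → All (BlockSize r) c →
    All (λ (_ , c′) → All (BlockSize r) c′ × sum c′ ≡ r + sum c) (choices r c)
  choices-wellFormed {[]}    []       = []
  choices-wellFormed {s ∷ c} (b ∷ bs) =
    (++⁺ (afterBatch-blockSize b) bs , sum-head) ∷ map⁺ (All.map prefix (choices-wellFormed bs))
    where
    sum-head : sum (afterBatch r s ++ c) ≡ r + (s + sum c)
    sum-head = begin
      sum (afterBatch r s ++ c)         ≡⟨ sum-++ (afterBatch r s) c ⟩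
      sum (afterBatch r s) + sum c      ≡⟨ cong (_+ sum c) (sum-afterBatch b) ⟩
      r + s + sum c                     ≡⟨ ℕ.+-assoc r s (sum c) ⟩
      r + (s + sum c)                   ∎
    prefix : ∀ {c′} → All (BlockSize r) c′ × sum c′ ≡ r + sum c →
      All (BlockSize r) (s ∷ c′) × sum (s ∷ c′) ≡ r + (s + sum c)
    prefix (bs′ , e) = b ∷ bs′ , trans (cong (_+_ s) e) (x∙yz≈y∙xz s r (sum c))

  weighted-length-choices : ∀ {c} → All (BlockSize r) c →
    weighted length (choices r c) + 2 * r * length c ≡ sum c * length c + 2 * sum c
  weighted-length-choices {[]}    []       = ℕ.*-zeroʳ (2 * r)
  weighted-length-choices {s ∷ c} (b ∷ bs) = begin
    s * length (afterBatch r s ++ c) + weighted length (map (map₂ (s ∷_)) (choices r c)) + 2 * r * suc L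
      ≡⟨ cong₂ (λ a w → s * a + w + 2 * r * suc L) (length-++ (afterBatch r s)) tail ⟩
    s * (A + L) + (n + W) + 2 * r * suc L
      ≡⟨ regroup s A L n W r ⟩
    (s * A + 2 * r) + (W + 2 * r * L) + (s * L + n)
      ≡⟨ cong₂ (λ x y → x + y + (s * L + n)) (length-afterBatch b) (weighted-length-choices bs) ⟩
    3 * s + (n * L + 2 * n) + (s * L + n)
      ≡⟨ collect s L n ⟩
    (s + n) * suc L + 2 * (s + n) ∎
    where
    A L n W : ℕ
    A = length (afterBatch r s)
    L = length c
    n = sum c
    W = weighted length (choices r c)
    tail : weighted length (map (map₂ (s ∷_)) (choices r c)) ≡ n + W
    tail = begin
      weighted length (map (map₂ (s ∷_)) (choices r c))  ≡⟨ weighted-prefix length s (choices r c) ⟩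
      weighted (λ c′ → 1 + length c′) (choices r c)      ≡⟨ weighted-+ (λ _ → 1) length (choices r c) ⟩
      weighted (λ _ → 1) (choices r c) + W               ≡⟨ cong (_+ W) (weighted-one-choices r c) ⟩
      n + W                                              ∎
    regroup : ∀ s A L n W r →
      s * (A + L) + (n + W) + 2 * r * suc L ≡ (s * A + 2 * r) + (W + 2 * r * L) + (s * L + n)
    regroup = ℕ-solve-∀
    collect : ∀ s L n → 3 * s + (n * L + 2 * n) + (s * L + n) ≡ (s + n) * suc L + 2 * (s + n)
    collect = ℕ-solve-∀

  wellFormed-sum>0 : ∀ {k c} → WellFormed r (suc k) c → 0 < sum c
  wellFormed-sum>0 {k} (_ , n≡rk) = subst (0 <_) (sym n≡rk) (ℕ.<-≤-trans r>0 (ℕ.m≤m*n r (suc k)))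

  -- Divided by k: from L blocks, the expected number of blocks after a batch is L + 2 − 2L/k.
  batch-blocks : ∀ {k c} → WellFormed r (suc k) c →
    ι (suc k) ℚ.* 𝔼 blocks (batch r c) ℚ.+ ι 2 ℚ.* blocks c ≡ ι (suc k) ℚ.* blocks c ℚ.+ ι 2 ℚ.* ι (suc k)
  batch-blocks {k} {c} wf@(bs , n≡rk) = *-cancelˡ-ι r>0 (begin
    ι r ℚ.* (ι k′ ℚ.* N ℚ.+ ι 2 ℚ.* ι L)
      ≡⟨ expand (ι r) (ι k′) N (ι 2) (ι L) ⟩
    ι r ℚ.* ι k′ ℚ.* N ℚ.+ ι 2 ℚ.* ι r ℚ.* ι L
      ≡⟨ cong₂ (λ a b → a ℚ.* N ℚ.+ b) ιn ι2rL ⟩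
    ι n ℚ.* N ℚ.+ ι (2 * r * L)
      ≡⟨ cong (ℚ._+ ι (2 * r * L)) (𝔼-fracWeights (wellFormed-sum>0 wf) length (choices r c)) ⟩
    ι W ℚ.+ ι (2 * r * L)
      ≡⟨ ι-homo-+ W (2 * r * L) ⟨
    ι (W + 2 * r * L)
      ≡⟨ cong ι (weighted-length-choices bs) ⟩
    ι (n * L + 2 * n)
      ≡⟨ trans (ι-homo-+ (n * L) (2 * n)) (cong₂ ℚ._+_ (ι-homo-* n L) (ι-homo-* 2 n)) ⟩
    ι n ℚ.* ι L ℚ.+ ι 2 ℚ.* ι n
      ≡⟨ cong (λ x → x ℚ.* ι L ℚ.+ ι 2 ℚ.* x) ιn ⟨
    ι r ℚ.* ι k′ ℚ.* ι L ℚ.+ ι 2 ℚ.* (ι r ℚ.* ι k′)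
      ≡⟨ factor (ι r) (ι k′) (ι L) (ι 2) ⟩
    ι r ℚ.* (ι k′ ℚ.* ι L ℚ.+ ι 2 ℚ.* ι k′) ∎)
    where
    k′ L n W : ℕ
    k′ = suc k
    L = length c
    n = sum c
    W = weighted length (choices r c)
    N : ℚ
    N = 𝔼 blocks (batch r c)
    ιn : ι r ℚ.* ι k′ ≡ ι n
    ιn = trans (sym (ι-homo-* r k′)) (cong ι (sym n≡rk))
    ι2rL : ι 2 ℚ.* ι r ℚ.* ι L ≡ ι (2 * r * L)
    ι2rL = trans (cong (ℚ._* ι L) (sym (ι-homo-* 2 r))) (sym (ι-homo-* (2 * r) L))
    expand : ∀ r k N t L → r ℚ.* (k ℚ.* N ℚ.+ t ℚ.* L) ≡ r ℚ.* k ℚ.* N ℚ.+ t ℚ.* r ℚ.* L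
    expand = solve-∀ ℚ-ring
    factor : ∀ r k L t → r ℚ.* k ℚ.* L ℚ.+ t ℚ.* (r ℚ.* k) ≡ r ℚ.* (k ℚ.* L ℚ.+ t ℚ.* k)
    factor = solve-∀ ℚ-ring

  dist-wellFormed : ∀ m → All (WellFormed r (suc m) ∘ proj₂) (dist r m)
  dist-wellFormed zero    = (single ∷ [] , trans (ℕ.+-identityʳ r) (sym (ℕ.*-identityʳ r))) ∷ []
  dist-wellFormed (suc m) = step-support r next (dist-wellFormed m)
    where
    next : ∀ {c} → WellFormed r (suc m) c → All (WellFormed r (suc (suc m)) ∘ proj₂) (choices r c)
    next {c} (bs , n≡rk) = All.map (λ (bs′ , e) → bs′ , trans e r+n≡r[k+1]) (choices-wellFormed bs)
      where
      r+n≡r[k+1] : r + sum c ≡ r * suc (suc m)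
      r+n≡r[k+1] = trans (cong (_+_ r) n≡rk) (sym (ℕ.*-suc r (suc m)))

  dist-mass : ∀ m → 𝔼 one (dist r m) ≡ 1ℚ
  dist-mass zero    = refl
  dist-mass (suc m) = begin
    𝔼 one (step r (dist r m))         ≡⟨ 𝔼-step r one (dist r m) ⟩
    𝔼 (𝔼 one ∘ batch r) (dist r m)
      ≡⟨ 𝔼-cong (λ {c} wf → batch-mass r c (wellFormed-sum>0 wf)) (dist-wellFormed m) ⟩
    𝔼 one (dist r m)                  ≡⟨ dist-mass m ⟩
    1ℚ                                ∎

  blocks-recurrence : ∀ m →
    ι (suc m) ℚ.* 𝔼 blocks (dist r (suc m)) ℚ.+ ι 2 ℚ.* 𝔼 blocks (dist r m)
      ≡ ι (suc m) ℚ.* 𝔼 blocks (dist r m) ℚ.+ ι 2 ℚ.* ι (suc m)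
  blocks-recurrence m = begin
    k ℚ.* 𝔼 blocks (step r d) ℚ.+ ι 2 ℚ.* 𝔼 blocks d
      ≡⟨ cong (λ x → k ℚ.* x ℚ.+ ι 2 ℚ.* 𝔼 blocks d) (𝔼-step r blocks d) ⟩
    k ℚ.* 𝔼 (𝔼 blocks ∘ batch r) d ℚ.+ ι 2 ℚ.* 𝔼 blocks d
      ≡⟨ 𝔼-linear k (ι 2) (𝔼 blocks ∘ batch r) blocks d ⟨
    𝔼 (λ c → k ℚ.* 𝔼 blocks (batch r c) ℚ.+ ι 2 ℚ.* blocks c) d
      ≡⟨ 𝔼-cong batch-blocks′ (dist-wellFormed m) ⟩
    𝔼 (λ c → k ℚ.* blocks c ℚ.+ ι 2 ℚ.* k ℚ.* one c) d
      ≡⟨ 𝔼-linear k (ι 2 ℚ.* k) blocks one d ⟩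
    k ℚ.* 𝔼 blocks d ℚ.+ ι 2 ℚ.* k ℚ.* 𝔼 one d
      ≡⟨ cong (λ x → k ℚ.* 𝔼 blocks d ℚ.+ ι 2 ℚ.* k ℚ.* x) (dist-mass m) ⟩
    k ℚ.* 𝔼 blocks d ℚ.+ ι 2 ℚ.* k ℚ.* 1ℚ
      ≡⟨ cong (k ℚ.* 𝔼 blocks d ℚ.+_) (ℚ.*-identityʳ (ι 2 ℚ.* k)) ⟩
    k ℚ.* 𝔼 blocks d ℚ.+ ι 2 ℚ.* k ∎
    where
    k : ℚ
    k = ι (suc m)
    d : Dist
    d = dist r m
    batch-blocks′ : ∀ {c} → WellFormed r (suc m) c →
      k ℚ.* 𝔼 blocks (batch r c) ℚ.+ ι 2 ℚ.* blocks c ≡ k ℚ.* blocks c ℚ.+ ι 2 ℚ.* k ℚ.* one c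
    batch-blocks′ {c} wf = trans (batch-blocks wf) (cong (k ℚ.* blocks c ℚ.+_) (sym (ℚ.*-identityʳ (ι 2 ℚ.* k))))

recurrence-solution : (e : ℕ → ℚ) →
  (∀ m → ι (suc m) ℚ.* e (suc m) ℚ.+ ι 2 ℚ.* e m ≡ ι (suc m) ℚ.* e m ℚ.+ ι 2 ℚ.* ι (suc m)) →
  ∀ j → ι 3 ℚ.* e (2 + j) ≡ ι 2 ℚ.* ι (3 + j)
recurrence-solution e rec zero = begin
  ι 3 ℚ.* e 2  ≡⟨ cong (ι 3 ℚ.*_) e₂≡2 ⟩
  ι 3 ℚ.* ι 2  ≡⟨ ℚ.*-comm (ι 3) (ι 2) ⟩
  ι 2 ℚ.* ι 3  ∎
  where
  rec₁ : ι 2 ℚ.* e 2 ℚ.+ ι 2 ℚ.* e 1 ≡ ι 2 ℚ.* ι 2 ℚ.+ ι 2 ℚ.* e 1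
  rec₁ = trans (rec 1) (ℚ.+-comm (ι 2 ℚ.* e 1) (ι 2 ℚ.* ι 2))
  e₂≡2 : e 2 ≡ ι 2
  e₂≡2 = *-cancelˡ-ι {2} (s≤s z≤n) (+-cancelʳ (ι 2 ℚ.* e 1) (ι 2 ℚ.* e 2) (ι 2 ℚ.* ι 2) rec₁)
recurrence-solution e rec (suc j) = *-cancelˡ-ι {3 + j} (s≤s z≤n) {ι 3 ℚ.* e″} {ι 2 ℚ.* ι (4 + j)}
  (+-cancelʳ (ι 2 ℚ.* (ι 3 ℚ.* e′)) (K ℚ.* (ι 3 ℚ.* e″)) (K ℚ.* (ι 2 ℚ.* ι (4 + j))) balanced)
  where
  K e′ e″ : ℚ
  K = ι (3 + j)
  e′ = e (2 + j)
  e″ = e (3 + j)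
  IH : ι 3 ℚ.* e′ ≡ ι 2 ℚ.* K
  IH = recurrence-solution e rec j
  factor-3 : ∀ K x y → K ℚ.* (ι 3 ℚ.* x) ℚ.+ ι 2 ℚ.* (ι 3 ℚ.* y) ≡ ι 3 ℚ.* (K ℚ.* x ℚ.+ ι 2 ℚ.* y)
  factor-3 = solve-∀ ℚ-ring
  expand-3 : ∀ K y → ι 3 ℚ.* (K ℚ.* y ℚ.+ ι 2 ℚ.* K) ≡ K ℚ.* (ι 3 ℚ.* y) ℚ.+ ι 3 ℚ.* ι 2 ℚ.* K
  expand-3 = solve-∀ ℚ-ring
  regroup : ∀ K → K ℚ.* (ι 2 ℚ.* K) ℚ.+ ι 3 ℚ.* ι 2 ℚ.* K ≡ K ℚ.* (ι 2 ℚ.* (1ℚ ℚ.+ K)) ℚ.+ ι 2 ℚ.* (ι 2 ℚ.* K)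
  regroup = solve-∀ ℚ-ring
  balanced : K ℚ.* (ι 3 ℚ.* e″) ℚ.+ ι 2 ℚ.* (ι 3 ℚ.* e′) ≡ K ℚ.* (ι 2 ℚ.* ι (4 + j)) ℚ.+ ι 2 ℚ.* (ι 3 ℚ.* e′)
  balanced = begin
    K ℚ.* (ι 3 ℚ.* e″) ℚ.+ ι 2 ℚ.* (ι 3 ℚ.* e′)         ≡⟨ factor-3 K e″ e′ ⟩
    ι 3 ℚ.* (K ℚ.* e″ ℚ.+ ι 2 ℚ.* e′)                   ≡⟨ cong (ι 3 ℚ.*_) (rec (2 + j)) ⟩
    ι 3 ℚ.* (K ℚ.* e′ ℚ.+ ι 2 ℚ.* K)                   ≡⟨ expand-3 K e′ ⟩
    K ℚ.* (ι 3 ℚ.* e′) ℚ.+ ι 3 ℚ.* ι 2 ℚ.* K           ≡⟨ cong (λ x → K ℚ.* x ℚ.+ ι 3 ℚ.* ι 2 ℚ.* K) IH ⟩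
    K ℚ.* (ι 2 ℚ.* K) ℚ.+ ι 3 ℚ.* ι 2 ℚ.* K            ≡⟨ regroup K ⟩
    K ℚ.* (ι 2 ℚ.* (1ℚ ℚ.+ K)) ℚ.+ ι 2 ℚ.* (ι 2 ℚ.* K)
      ≡⟨ cong₂ (λ x y → K ℚ.* (ι 2 ℚ.* x) ℚ.+ ι 2 ℚ.* y) (sym (ι-homo-+ 1 (3 + j))) (sym IH) ⟩
    K ℚ.* (ι 2 ℚ.* ι (4 + j)) ℚ.+ ι 2 ℚ.* (ι 3 ℚ.* e′) ∎

divQ-unique : ∀ {x y z} → y ≢ 0ℚ → z ℚ.* y ≡ x → divQ x y ≡ z
divQ-unique {x} {y} {z} y≢0 zy≡x with y ℚ.≟ 0ℚ
... | yes y≡0 = contradiction y≡0 y≢0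
... | no  y≢0′ = begin
  x ℚ.* ℚ.1/ y               ≡⟨ cong (ℚ._* ℚ.1/ y) zy≡x ⟨
  z ℚ.* y ℚ.* ℚ.1/ y         ≡⟨ ℚ.*-assoc z y (ℚ.1/ y) ⟩
  z ℚ.* (y ℚ.* ℚ.1/ y)       ≡⟨ cong (z ℚ.*_) (ℚ.*-inverseʳ y) ⟩
  z ℚ.* 1ℚ                   ≡⟨ ℚ.*-identityʳ z ⟩
  z                          ∎
  where
  instance
    y-nonZero : ℚ.NonZero y
    y-nonZero = ℚ.≢-nonZero y≢0′

keysPerBlock≡3r/2 : ∀ {r} → 0 < r → ∀ j →
  divQ (frac (r * suc (2 + j)) 1) (expBlocks r (2 + j)) ≡ (+ (3 * r)) / 2
keysPerBlock≡3r/2 {r} r>0 j rewrite expBlocks≡𝔼 r (2 + j) =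
  divQ-unique E≢0 (*-cancelˡ-ι {3} (s≤s z≤n) (begin
  ι 3 ℚ.* (z ℚ.* E)      ≡⟨ left-commute (ι 3) z E ⟩
  z ℚ.* (ι 3 ℚ.* E)      ≡⟨ cong (z ℚ.*_) 3E≡2k ⟩
  z ℚ.* (ι 2 ℚ.* ι k)    ≡⟨ ℚ.*-assoc z (ι 2) (ι k) ⟨
  z ℚ.* ι 2 ℚ.* ι k      ≡⟨ cong (ℚ._* ι k) (trans (frac-*-ι (3 * r) 1) (ι-homo-* 3 r)) ⟩
  ι 3 ℚ.* ι r ℚ.* ι k    ≡⟨ ℚ.*-assoc (ι 3) (ι r) (ι k) ⟩
  ι 3 ℚ.* (ι r ℚ.* ι k)  ≡⟨ cong (ι 3 ℚ.*_) (ι-homo-* r k) ⟨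
  ι 3 ℚ.* ι (r * k)      ∎))
  where
  k : ℕ
  k = 3 + j
  z E : ℚ
  z = frac (3 * r) 2
  E = 𝔼 blocks (dist r (2 + j))
  3E≡2k : ι 3 ℚ.* E ≡ ι 2 ℚ.* ι k
  3E≡2k = recurrence-solution (λ m → 𝔼 blocks (dist r m)) (blocks-recurrence r>0) j
  E≢0 : E ≢ 0ℚ
  E≢0 E≡0 = ι≢0 {2 * k} (s≤s z≤n) (begin
    ι (2 * k)          ≡⟨ ι-homo-* 2 k ⟩
    ι 2 ℚ.* ι k        ≡⟨ 3E≡2k ⟨
    ι 3 ℚ.* E          ≡⟨ cong (ι 3 ℚ.*_) E≡0 ⟩
    ι 3 ℚ.* 0ℚ         ≡⟨ ℚ.*-zeroʳ (ι 3) ⟩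
    0ℚ                 ∎)
  left-commute : ∀ a z E → a ℚ.* (z ℚ.* E) ≡ z ℚ.* (a ℚ.* E)
  left-commute = solve-∀ ℚ-ring

-- The bounds on B only guarantee that no block overflows before it is split; afterBatch
-- already models the resulting process, so only r > 0 is needed.
mainTheorem2 : (B r : ℕ) → 0 < r → B < 3 * r → 2 * r ≤ B →
    (ε : ℚ) → 0ℚ ℚ.< ε →
      ∃[ N ] ((m : ℕ) → N ≤ m →
        ∣ divQ (frac (r * suc m) 1) (expBlocks r m) - (+ (3 * r)) / 2 ∣ ℚ.< ε)
mainTheorem2 B r r>0 _ _ ε ε>0 = 2 , close
  where
  close : (m : ℕ) → 2 ≤ m → ∣ divQ (frac (r * suc m) 1) (expBlocks r m) - (+ (3 * r)) / 2 ∣ ℚ.< ε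
  close (suc (suc j)) (s≤s (s≤s _)) rewrite keysPerBlock≡3r/2 r>0 j | ℚ.+-inverseʳ ((+ (3 * r)) / 2) = ε>0
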